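{- Let $D=\{2^i\mid i\in\mathbb{Z}_{\ge0}\}$. Let $\mathbf{s}^{(1)}$ be the expansion of a binary string $\mathbf{s}$, and let $x_1<\dots<x_k$ be a $D$-diffsequence of positions in $\mathbf{s}^{(1)}$ that is monochromatic of color $c\in\{0,1\}$, i.e. $s^{(1)}_{x_i}=c$ for all $i$. Then there exists a nonnegative integer $m\le k$ such that, for each $j\in\{1,\dots,k\}$, $s_{\mathrm{pos}(x_j)}=1-c$ if and only if $j\le m$.
   Context: A $D$-diffsequence is a sequence of positive integers $a_1<\dots<a_k$ with $a_{i+1}-a_i\in D$ for all $i\in\{1,\dots,k-1\}$. The expansion of a binary string $\mathbf{s}$ of length $l$ is the binary string $\mathbf{s}^{(1)}$ of length $4l$ obtained by replacing each $0$ in $\mathbf{s}$ by $0011$ and each $1$ by $1100$; equivalently, for $i\in\{1,\dots,l\}$ and $j\in\{0,1,2,3\}$, $s^{(1)}_{4i-j}=s_i$ if $j\in\{2,3\}$ and $s^{(1)}_{4i-j}=1-s_i$ if $j\in\{0,1\}$. For a positive integer $i$, $\mathrm{pos}(i)=\lceil i/4\rceil$. -}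

module Defs where

open import Data.Nat using (ℕ; zero; suc; _+_; _*_; _∸_; _^_; _≤_; _<_)
open import Data.Nat.DivMod using (_/_)
open import Data.Bool using (Bool; true; false; not)
open import Data.Fin using (Fin; toℕ)
open import Data.Product using (∃-syntax; _×_)
open import Relation.Binary.PropositionalEquality using (_≡_)

-- Binary strings of length l are modelled as functions s : ℕ → Bool,
-- read 1-indexed: s i is the letter s_i for 1 ≤ i ≤ l (other values unused).
-- Bits: false = 0, true = 1.

InD : ℕ → Set
InD d = ∃[ e ] d ≡ 2 ^ e

pos : ℕ → ℕ
pos i = (i + 3) / 4

-- The expansion s⁽¹⁾ (1-indexed, positions 1..4l):
-- s⁽¹⁾_{4i-j} = s_i if j ∈ {2,3}, = 1 - s_i if j ∈ {0,1}.
-- For a position p, i = pos p and j = 4 i - p ∈ {0,1,2,3}.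
expansion : (ℕ → Bool) → ℕ → Bool
expansion s p with 4 * pos p ∸ p
... | 0 = not (s (pos p))
... | 1 = not (s (pos p))
... | _ = s (pos p)

-- A sequence x_1 < ... < x_k is given as x : Fin k → ℕ, with x_j = x (j-1).
-- It is a D-diffsequence iff consecutive elements are increasing with differences in D.
IsDDiffseq : (k : ℕ) → (Fin k → ℕ) → Set
IsDDiffseq k x = (a b : Fin k) → suc (toℕ a) ≡ toℕ b →
  (x a < x b) × InD (x b ∸ x a)

{-# OPTIONS --safe #-}
module Submission where

-- In the expansion, block i occupies positions 4i-3, …, 4i: the first two copy s_i and the last two
-- carry 1 - s_i. Call the last two flipped; a position of colour c is flipped exactly when its letter
-- of s is 1 - c. A step 2^e with e ≥ 2 preserves the residue mod 4, hence flippedness. A step of 1 or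
-- 2 from a copying position either lands on a copying position or stays inside the same block, where
-- a flipped position has the other colour. So along a monochromatic D-diffsequence no flipped
-- position follows a copying one, and the flipped positions form an initial segment x_1, …, x_m.

open import Defs
open import Data.Nat using (ℕ; zero; suc; _*_; _+_; _∸_; _^_; _≤_; _<_; _<ᵇ_; z≤n; s≤s; s≤s⁻¹)
open import Data.Nat.Properties using (*-suc; *-assoc; *-comm; +-comm; m+[n∸m]≡n; <⇒≤; ≤-refl; n≮0)
open import Data.Nat.DivMod using (m/n≡1+[m∸n]/n)
open import Data.Bool using (Bool; true; false; not; _xor_; _≟_)
open import Data.Fin using (Fin; toℕ; zero; suc)
open import Data.Product using (∃-syntax; _×_; _,_)
open import Data.Empty using (⊥-elim)
open import Function using (_∘_)
open import Function.Bundles using (_⇔_; mk⇔; Equivalence)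
open Equivalence using (to; from)
open import Function.Construct.Composition using (_⇔-∘_)
open import Relation.Nullary using (yes; no)
open import Relation.Unary using (Pred; Decidable)
open import Relation.Binary.PropositionalEquality using (_≡_; refl; sym; trans; cong; subst; module ≡-Reasoning)

PredecessorClosed : ∀ {k ℓ} → Pred (Fin k) ℓ → Set ℓ
PredecessorClosed P = ∀ {i j} → suc (toℕ i) ≡ toℕ j → P j → P i

predecessorClosed⇒initialSegment : ∀ {k ℓ} {P : Pred (Fin k) ℓ} → Decidable P → PredecessorClosed P →
  ∃[ m ] m ≤ k × (∀ j → P j ⇔ toℕ j < m)
predecessorClosed⇒initialSegment {zero} _ _ = 0 , z≤n , λ ()
predecessorClosed⇒initialSegment {suc k} P? closed
  with predecessorClosed⇒initialSegment (P? ∘ suc) (closed ∘ cong suc) | P? zero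
... | m , m≤k , P∘suc⇔<m | yes P0 = suc m , s≤s m≤k , λ
  { zero    → mk⇔ (λ _ → s≤s z≤n) (λ _ → P0)
  ; (suc j) → mk⇔ (s≤s ∘ to (P∘suc⇔<m j)) (from (P∘suc⇔<m j) ∘ s≤s⁻¹) }
... | zero , _ , P∘suc⇔<0 | no ¬P0 = 0 , z≤n , λ
  { zero    → mk⇔ (⊥-elim ∘ ¬P0) λ ()
  ; (suc j) → mk⇔ (λ Psj → ⊥-elim (n≮0 (to (P∘suc⇔<0 j) Psj))) λ () }
... | suc m , s≤s _ , P∘suc⇔<m | no ¬P0 = ⊥-elim (¬P0 (closed refl (from (P∘suc⇔<m zero) (s≤s z≤n))))

xor-cancelʳ : ∀ x y z → x xor z ≡ y xor z → x ≡ y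
xor-cancelʳ false false z _ = refl
xor-cancelʳ false true false ()
xor-cancelʳ false true true ()
xor-cancelʳ true false false ()
xor-cancelʳ true false true ()
xor-cancelʳ true true z _ = refl

xor≡⇒≡not⇔≡true : ∀ f b {c} → f xor b ≡ c → (b ≡ not c) ⇔ (f ≡ true)
xor≡⇒≡not⇔≡true false false refl = mk⇔ (λ ()) (λ ())
xor≡⇒≡not⇔≡true false true  refl = mk⇔ (λ ()) (λ ())
xor≡⇒≡not⇔≡true true  false refl = mk⇔ (λ _ → refl) (λ _ → refl)
xor≡⇒≡not⇔≡true true  true  refl = mk⇔ (λ _ → refl) (λ _ → refl)

pos-+4 : ∀ p → pos (4 + p) ≡ suc (pos p)
pos-+4 p = m/n≡1+[m∸n]/n {4 + (p + 3)} {4} (s≤s (s≤s (s≤s (s≤s z≤n))))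

offset-+4 : ∀ p → 4 * pos (4 + p) ∸ (4 + p) ≡ 4 * pos p ∸ p
offset-+4 p = trans (cong (λ i → 4 * i ∸ (4 + p)) (pos-+4 p)) (cong (_∸ (4 + p)) (*-suc 4 (pos p)))

flipped : ℕ → Bool
flipped 0 = true
flipped 1 = false
flipped 2 = false
flipped 3 = true
flipped (suc (suc (suc (suc p)))) = flipped p

flipped≡offset<2 : ∀ p → flipped p ≡ (4 * pos p ∸ p <ᵇ 2)
flipped≡offset<2 0 = refl
flipped≡offset<2 1 = refl
flipped≡offset<2 2 = refl
flipped≡offset<2 3 = refl
flipped≡offset<2 (suc (suc (suc (suc p)))) = trans (flipped≡offset<2 p) (cong (_<ᵇ 2) (sym (offset-+4 p)))

expansion≡flipped-xor : ∀ s p → expansion s p ≡ flipped p xor s (pos p)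
expansion≡flipped-xor s p rewrite flipped≡offset<2 p with 4 * pos p ∸ p
... | 0 = refl
... | 1 = refl
... | suc (suc _) = refl

flipped-periodic : ∀ n p → flipped (n * 4 + p) ≡ flipped p
flipped-periodic zero p = refl
flipped-periodic (suc n) p = flipped-periodic n p

same-block⇒flipped-determined : ∀ s p q → pos p ≡ pos q → expansion s p ≡ expansion s q → flipped p ≡ flipped q
same-block⇒flipped-determined s p q same-pos same-colour = xor-cancelʳ (flipped p) (flipped q) (s (pos q)) (begin
  flipped p xor s (pos q) ≡⟨ cong (λ i → flipped p xor s i) same-pos ⟨
  flipped p xor s (pos p) ≡⟨ expansion≡flipped-xor s p ⟨
  expansion s p           ≡⟨ same-colour ⟩
  expansion s q           ≡⟨ expansion≡flipped-xor s q ⟩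
  flipped q xor s (pos q) ∎)
  where open ≡-Reasoning

copied→flipped⇒same-block : ∀ p d → d ≤ 2 → flipped p ≡ false → flipped (p + d) ≡ true → pos p ≡ pos (p + d)
copied→flipped⇒same-block 1 2 _ _ _ = refl
copied→flipped⇒same-block 2 1 _ _ _ = refl
copied→flipped⇒same-block 2 2 _ _ _ = refl
copied→flipped⇒same-block 1 (suc (suc (suc _))) (s≤s (s≤s ())) _ _
copied→flipped⇒same-block 2 (suc (suc (suc _))) (s≤s (s≤s ())) _ _
copied→flipped⇒same-block (suc (suc (suc (suc p)))) d d≤2 p-copied q-flipped = begin
  pos (4 + p)       ≡⟨ pos-+4 p ⟩
  suc (pos p)       ≡⟨ cong suc (copied→flipped⇒same-block p d d≤2 p-copied q-flipped) ⟩
  suc (pos (p + d)) ≡⟨ pos-+4 (p + d) ⟨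
  pos (4 + (p + d)) ∎
  where open ≡-Reasoning

flipped-descends-within-block : ∀ s p d → d ≤ 2 → expansion s p ≡ expansion s (p + d) →
  flipped (p + d) ≡ true → flipped p ≡ true
flipped-descends-within-block s p d d≤2 same-colour q-flipped with flipped p in p-flipped
... | true = refl
... | false = begin
  false           ≡⟨ p-flipped ⟨
  flipped p       ≡⟨ same-block⇒flipped-determined s p (p + d) same-block same-colour ⟩
  flipped (p + d) ≡⟨ q-flipped ⟩
  true            ∎
  where
  open ≡-Reasoning
  same-block : pos p ≡ pos (p + d)
  same-block = copied→flipped⇒same-block p d d≤2 p-flipped q-flipped

flipped-+2^[2+e] : ∀ p e → flipped (p + 2 ^ (2 + e)) ≡ flipped p
flipped-+2^[2+e] p e = trans (cong flipped p+2^[2+e]≡2^e*4+p) (flipped-periodic (2 ^ e) p)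
  where
  p+2^[2+e]≡2^e*4+p : p + 2 * (2 * 2 ^ e) ≡ 2 ^ e * 4 + p
  p+2^[2+e]≡2^e*4+p = trans (+-comm p _) (cong (_+ p) (trans (sym (*-assoc 2 2 (2 ^ e))) (*-comm 4 (2 ^ e))))

flipped-descends-by-2^ : ∀ s p e → expansion s p ≡ expansion s (p + 2 ^ e) →
  flipped (p + 2 ^ e) ≡ true → flipped p ≡ true
flipped-descends-by-2^ s p 0 = flipped-descends-within-block s p 1 (s≤s z≤n)
flipped-descends-by-2^ s p 1 = flipped-descends-within-block s p 2 ≤-refl
flipped-descends-by-2^ s p (suc (suc e)) _ q-flipped = trans (sym (flipped-+2^[2+e] p e)) q-flipped

flipped-descends : ∀ s {p q} → p < q × InD (q ∸ p) → expansion s p ≡ expansion s q →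
  flipped q ≡ true → flipped p ≡ true
flipped-descends s {p} {q} (p<q , e , q∸p≡2^e) =
  subst (λ r → expansion s p ≡ expansion s r → flipped r ≡ true → flipped p ≡ true)
        p+2^e≡q (flipped-descends-by-2^ s p e)
  where
  p+2^e≡q : p + 2 ^ e ≡ q
  p+2^e≡q = trans (cong (p +_) (sym q∸p≡2^e)) (m+[n∸m]≡n (<⇒≤ p<q))

mismatch⇔flipped : ∀ s p {c} → expansion s p ≡ c → (s (pos p) ≡ not c) ⇔ (flipped p ≡ true)
mismatch⇔flipped s p colour =
  xor≡⇒≡not⇔≡true (flipped p) (s (pos p)) (trans (sym (expansion≡flipped-xor s p)) colour)

corollary1 : (l : ℕ) (s : ℕ → Bool) (k : ℕ) (x : Fin k → ℕ) (c : Bool) →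
    ((j : Fin k) → (1 ≤ x j) × (x j ≤ 4 * l)) →
    IsDDiffseq k x →
    ((j : Fin k) → expansion s (x j) ≡ c) →
    ∃[ m ] (m ≤ k) × ((j : Fin k) → (s (pos (x j)) ≡ not c) ⇔ (suc (toℕ j) ≤ m))
corollary1 _ s _ x c _ x-diffseq x-colour =
  let m , m≤k , flipped⇔<m = predecessorClosed⇒initialSegment (λ j → flipped (x j) ≟ true) flipped-closed
  in  m , m≤k , λ j → flipped⇔<m j ⇔-∘ mismatch⇔flipped s (x j) (x-colour j)
  where
  flipped-closed : PredecessorClosed (λ j → flipped (x j) ≡ true)
  flipped-closed {i} {j} i→j = flipped-descends s (x-diffseq i j i→j) (trans (x-colour i) (sym (x-colour j)))
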